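{- For every formula $A$ of LMRL, the sequent $\vdash\Omega\{A\}$ is derivable in LMRL.
   Context: Fix a set $\Omega$ of roles (possibly infinite). A role set is a subset $R\subseteq\Omega$; $\overline{R}=\Omega\setminus R$; $R_1\uplus\cdots\uplus R_n=\Omega$ means the $R_i$ are pairwise disjoint with union $\Omega$. An ultrafilter on $\Omega$ is a family $\mathcal U$ of subsets of $\Omega$ with $\Omega\in\mathcal U$, closed upward and under binary intersection, and containing $R$ or $\overline R$ for every $R$. For an endomorphism $f$ of $\Omega$, $f^{ -1}(R)=\{r\mid f(r)\in R\}$. Formulas of LMRL (linear multirole logic), over first-order terms $t$ and variables $x$: $A,B::=a\mid\neg_f(A)\mid A\otimes_{\mathcal U}B\mid A\,\&_{\mathcal U}B\mid !_{\mathcal U}(A)\mid\forall_{\mathcal U}(\lambda x.A)$ ($a$ primitive, $f$ endomorphisms, $\mathcal U$ ultrafilters); $A[x:=t]$ is substitution. An i-formula is $R\{A\}$; a sequent is a finite multiset of i-formulas. $?(\Gamma)$ denotes a sequent every i-formula of which has the form $R\{!_{\mathcal U}(C)\}$ with $R\notin\mathcal U$. Rules of LMRL: (Id) $\vdash R_1\{a\},\ldots,R_n\{a\}$ whenever $R_1\uplus\cdots\uplus R_n=\Omega$; ($\neg$) from $\Gamma,f^{ -1}(R)\{A\}$ infer $\Gamma,R\{\neg_f(A)\}$; ($\&$-neg-l/r) if $R\notin\mathcal U$, from $\Gamma,R\{A\}$ (resp. $\Gamma,R\{B\}$) infer $\Gamma,R\{A\,\&_{\mathcal U}B\}$; ($\&$-pos)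 if $R\in\mathcal U$, from $\Gamma,R\{A\}$ and $\Gamma,R\{B\}$ infer $\Gamma,R\{A\,\&_{\mathcal U}B\}$; ($\otimes$-neg) if $R\notin\mathcal U$, from $\Gamma,R\{A\},R\{B\}$ infer $\Gamma,R\{A\otimes_{\mathcal U}B\}$; ($\otimes$-pos) if $R\in\mathcal U$, from $\Gamma_1,R\{A\}$ and $\Gamma_2,R\{B\}$ infer $\Gamma_1,\Gamma_2,R\{A\otimes_{\mathcal U}B\}$; ($!$-pos) if $R\in\mathcal U$, from $?(\Gamma),R\{A\}$ infer $?(\Gamma),R\{!_{\mathcal U}(A)\}$; ($!$-neg-weaken) if $R\notin\mathcal U$, from $\Gamma$ infer $\Gamma,R\{!_{\mathcal U}(A)\}$; ($!$-neg-derelict) if $R\notin\mathcal U$, from $\Gamma,R\{A\}$ infer $\Gamma,R\{!_{\mathcal U}(A)\}$; ($!$-neg-contract) if $R\notin\mathcal U$, from $\Gamma,R\{!_{\mathcal U}(A)\},R\{!_{\mathcal U}(A)\}$ infer $\Gamma,R\{!_{\mathcal U}(A)\}$; ($\forall$-neg) if $R\notin\mathcal U$, from $\Gamma,R\{A[x:=t]\}$ infer $\Gamma,R\{\forall_{\mathcal U}(\lambda x.A)\}$; ($\forall$-pos) if $R\in\mathcal U$ and $x$ not free in $\Gamma$, from $\Gamma,R\{A\}$ infer $\Gamma,R\{\forall_{\mathcal U}(\lambda x.A)\}$. -}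

module Defs where

open import Level using (0ℓ)
open import Data.Nat using (ℕ; _≡ᵇ_)
open import Data.Bool using (Bool; true; false; _∨_; _∧_; not; if_then_else_)
open import Data.Fin using (Fin)
open import Data.List using (List; []; _∷_; _++_; tabulate)
open import Data.List.Relation.Unary.All using (All)
open import Data.List.Relation.Binary.Permutation.Propositional using (_↭_)
open import Data.Product using (Σ; _×_; ∃)
open import Data.Sum using (_⊎_)
open import Relation.Nullary using (¬_)
open import Relation.Unary using (Pred; _⊆_; _∩_; ∁) renaming (U to Univ)
open import Relation.Binary.PropositionalEquality using (_≡_)

data Term : Set where
  var : ℕ → Term
  fun : ℕ → List Term → Term

mutual
  substT : Term → ℕ → Term → Term
  substT (var y) x t = if y ≡ᵇ x then t else var y
  substT (fun g ts) x t = fun g (substTs ts x t)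

  substTs : List Term → ℕ → Term → List Term
  substTs [] x t = []
  substTs (s ∷ ss) x t = substT s x t ∷ substTs ss x t

mutual
  occursT : ℕ → Term → Bool
  occursT x (var y) = x ≡ᵇ y
  occursT x (fun g ts) = occursTs x ts

  occursTs : ℕ → List Term → Bool
  occursTs x [] = false
  occursTs x (s ∷ ss) = occursT x s ∨ occursTs x ss

module LMRL (Role : Set) where

  RoleSet : Set₁
  RoleSet = Pred Role 0ℓ

  Ω : RoleSet
  Ω = Univ

  _⁻¹[_] : (Role → Role) → RoleSet → RoleSet
  (f ⁻¹[ R ]) r = R (f r)

  record Ultrafilter : Set₁ where
    field
      _∋_      : RoleSet → Set
      has-Ω    : _∋_ Ω
      upward   : ∀ {R S} → R ⊆ S → _∋_ R → _∋_ S
      inter    : ∀ {R S} → _∋_ R → _∋_ S → _∋_ (R ∩ S)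
      ultra    : ∀ R → _∋_ R ⊎ _∋_ (∁ R)
  open Ultrafilter public

  data Formula : Set₁ where
    prim   : ℕ → List Term → Formula
    neg    : (Role → Role) → Formula → Formula
    tensor : Ultrafilter → Formula → Formula → Formula
    with′  : Ultrafilter → Formula → Formula → Formula
    bang   : Ultrafilter → Formula → Formula
    all    : Ultrafilter → ℕ → Formula → Formula   -- ∀_U (λ x. A)

  freeIn : ℕ → Formula → Bool
  freeIn x (prim p ts) = occursTs x ts
  freeIn x (neg f A) = freeIn x A
  freeIn x (tensor U A B) = freeIn x A ∨ freeIn x B
  freeIn x (with′ U A B) = freeIn x A ∨ freeIn x B
  freeIn x (bang U A) = freeIn x A
  freeIn x (all U y A) = if y ≡ᵇ x then false else freeIn x A

  subst : Formula → ℕ → Term → Formula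
  subst (prim p ts) x t = prim p (substTs ts x t)
  subst (neg f A) x t = neg f (subst A x t)
  subst (tensor U A B) x t = tensor U (subst A x t) (subst B x t)
  subst (with′ U A B) x t = with′ U (subst A x t) (subst B x t)
  subst (bang U A) x t = bang U (subst A x t)
  subst (all U y A) x t = if y ≡ᵇ x then all U y A else all U y (subst A x t)

  freeFor : Term → ℕ → Formula → Bool
  freeFor t x (prim p ts) = true
  freeFor t x (neg f A) = freeFor t x A
  freeFor t x (tensor U A B) = freeFor t x A ∧ freeFor t x B
  freeFor t x (with′ U A B) = freeFor t x A ∧ freeFor t x B
  freeFor t x (bang U A) = freeFor t x A
  freeFor t x (all U y A) =
    if y ≡ᵇ x then true
    else (not (freeIn x A) ∨ (not (occursT y t) ∧ freeFor t x A))

  -- i-formulas and sequents (multisets = lists up to permutation)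
  record IFormula : Set₁ where
    constructor _｛_｝
    field
      role    : RoleSet
      formula : Formula

  Sequent : Set₁
  Sequent = List IFormula

  -- the i-formulas allowed in ?(Γ)
  data WhyNot : IFormula → Set₁ where
    whyNot : ∀ {R U C} → ¬ (U ∋ R) → WhyNot (R ｛ bang U C ｝)

  NotFreeIn : ℕ → Sequent → Set₁
  NotFreeIn x Γ = All (λ F → freeIn x (IFormula.formula F) ≡ false) Γ

  IsPartition : (n : ℕ) → (Fin n → RoleSet) → Set
  IsPartition n Rs =
    (∀ r → ∃ λ i → Rs i r) ×
    (∀ i j r → Rs i r → Rs j r → i ≡ j)

  data ⊢_ : Sequent → Set₁ where
    exch : ∀ {Γ Δ} → ⊢ Γ → Γ ↭ Δ → ⊢ Δ
    Id : ∀ n (Rs : Fin n → RoleSet) p ts → IsPartition n Rs →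
         ⊢ tabulate (λ i → Rs i ｛ prim p ts ｝)
    ¬-rule : ∀ {Γ R f A} → ⊢ ((f ⁻¹[ R ]) ｛ A ｝ ∷ Γ) → ⊢ (R ｛ neg f A ｝ ∷ Γ)
    &-neg-l : ∀ {Γ R U A B} → ¬ (U ∋ R) →
              ⊢ (R ｛ A ｝ ∷ Γ) → ⊢ (R ｛ with′ U A B ｝ ∷ Γ)
    &-neg-r : ∀ {Γ R U A B} → ¬ (U ∋ R) →
              ⊢ (R ｛ B ｝ ∷ Γ) → ⊢ (R ｛ with′ U A B ｝ ∷ Γ)
    &-pos : ∀ {Γ R U A B} → U ∋ R →
            ⊢ (R ｛ A ｝ ∷ Γ) → ⊢ (R ｛ B ｝ ∷ Γ) → ⊢ (R ｛ with′ U A B ｝ ∷ Γ)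
    ⊗-neg : ∀ {Γ R U A B} → ¬ (U ∋ R) →
            ⊢ (R ｛ A ｝ ∷ R ｛ B ｝ ∷ Γ) → ⊢ (R ｛ tensor U A B ｝ ∷ Γ)
    ⊗-pos : ∀ {Γ₁ Γ₂ R U A B} → U ∋ R →
            ⊢ (R ｛ A ｝ ∷ Γ₁) → ⊢ (R ｛ B ｝ ∷ Γ₂) →
            ⊢ (R ｛ tensor U A B ｝ ∷ Γ₁ ++ Γ₂)
    !-pos : ∀ {Γ R U A} → All WhyNot Γ → U ∋ R →
            ⊢ (R ｛ A ｝ ∷ Γ) → ⊢ (R ｛ bang U A ｝ ∷ Γ)
    !-neg-weaken : ∀ {Γ R U A} → ¬ (U ∋ R) →
                   ⊢ Γ → ⊢ (R ｛ bang U A ｝ ∷ Γ)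
    !-neg-derelict : ∀ {Γ R U A} → ¬ (U ∋ R) →
                     ⊢ (R ｛ A ｝ ∷ Γ) → ⊢ (R ｛ bang U A ｝ ∷ Γ)
    !-neg-contract : ∀ {Γ R U A} → ¬ (U ∋ R) →
                     ⊢ (R ｛ bang U A ｝ ∷ R ｛ bang U A ｝ ∷ Γ) →
                     ⊢ (R ｛ bang U A ｝ ∷ Γ)
    ∀-neg : ∀ {Γ R U x A} t → ¬ (U ∋ R) → freeFor t x A ≡ true →
            ⊢ (R ｛ subst A x t ｝ ∷ Γ) → ⊢ (R ｛ all U x A ｝ ∷ Γ)
    ∀-pos : ∀ {Γ R U x A} → U ∋ R → NotFreeIn x Γ →
            ⊢ (R ｛ A ｝ ∷ Γ) → ⊢ (R ｛ all U x A ｝ ∷ Γ)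

{-# OPTIONS --safe #-}
-- Since every ultrafilter contains Ω, each connective at role set Ω is
-- introduced by its positive rule with empty context; primitive formulas
-- are axioms for the one-block partition of Ω.
module Submission where

open import Defs
open import Data.List using ([]; _∷_)
open import Data.List.Relation.Unary.All using ([])
open import Data.Fin using (zero)
open import Data.Unit using (tt)
open import Data.Product using (_,_)
open import Relation.Binary.PropositionalEquality using (refl)

module _ (Role : Set) where
  open LMRL Role

  Ω-isPartition : IsPartition 1 (λ _ → Ω)
  Ω-isPartition = (λ _ → zero , tt) , λ { zero zero _ _ _ → refl }

  ⊢Ω : (A : Formula) → ⊢ (Ω ｛ A ｝ ∷ [])
  ⊢Ω (prim p ts)    = Id 1 (λ _ → Ω) p ts Ω-isPartition
  ⊢Ω (neg f A)      = ¬-rule (⊢Ω A)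
  ⊢Ω (tensor U A B) = ⊗-pos {Γ₁ = []} {Γ₂ = []} (has-Ω U) (⊢Ω A) (⊢Ω B)
  ⊢Ω (with′ U A B)  = &-pos (has-Ω U) (⊢Ω A) (⊢Ω B)
  ⊢Ω (bang U A)     = !-pos [] (has-Ω U) (⊢Ω A)
  ⊢Ω (all U x A)    = ∀-pos (has-Ω U) [] (⊢Ω A)

lemma8 : (Role : Set) → (A : LMRL.Formula Role) →
    LMRL.⊢_ Role (LMRL._｛_｝ (LMRL.Ω Role) A ∷ [])
lemma8 = ⊢Ω
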